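{- Let $k>1$ be an integer. A $k$-irreducible pair $\{A,B\}$ has length $\ell(A,B)=2k-1$ if and only if $\{A,B\}$ is the pair consisting of the multiset $\{k,k,\ldots,k\}$ ($k-1$ copies of $k$) and the multiset $\{k-1,k-1,\ldots,k-1\}$ ($k$ copies of $k-1$).
   Context: For a finite multiset $S$, $|S|$ is the number of elements of $S$ counted with multiplicity, $\max(S)$ is its largest element, and $\Sigma S=\sum_{s\in S}s$ (with multiplicity). For nonempty finite multisets $A,B$ of positive integers, the (unordered) pair $\{A,B\}$ is called irreducible if $\Sigma A=\Sigma B$ and for every nonempty proper multisubsets $A'\subsetneq A$ and $B'\subsetneq B$ one has $\Sigma A'\neq \Sigma B'$. For a positive integer $k$, an irreducible pair $\{A,B\}$ is called $k$-irreducible if $\max(A\cup B)\leq k$. The length of $\{A,B\}$ is $\ell(A,B)=|A|+|B|$. -}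

module Defs where

open import Data.Nat using (ℕ; _≤_; _<_; _+_; _*_; _∸_)
open import Data.Nat.ListAction using (sum)
open import Data.List using (List; []; length; replicate; _++_)
open import Data.List.Relation.Unary.All using (All)
open import Data.List.Relation.Binary.Sublist.Propositional using (_⊆_)
open import Data.List.Relation.Binary.Permutation.Propositional using (_↭_)
open import Data.Product using (_×_)
open import Data.Sum using (_⊎_)
open import Relation.Binary.PropositionalEquality using (_≡_; _≢_)

-- Finite multisets of naturals are represented by lists, considered up to
-- permutation (_↭_).  A multisubset of A is (up to reordering) a sublist of A;
-- it is proper iff it has fewer elements than A.

PosMultiset : List ℕ → Set
PosMultiset A = (A ≢ []) × All (λ x → 1 ≤ x) A

NonemptyProperSub : List ℕ → List ℕ → Set
NonemptyProperSub A' A = (A' ⊆ A) × (A' ≢ []) × (length A' < length A)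

Irreducible : List ℕ → List ℕ → Set
Irreducible A B =
  PosMultiset A × PosMultiset B × (sum A ≡ sum B) ×
  (∀ A' B' → NonemptyProperSub A' A → NonemptyProperSub B' B → sum A' ≢ sum B')

KIrreducible : ℕ → List ℕ → List ℕ → Set
KIrreducible k A B = Irreducible A B × All (λ x → x ≤ k) (A ++ B)

ℓ : List ℕ → List ℕ → ℕ
ℓ A B = length A + length B

SamePair : List ℕ → List ℕ → List ℕ → List ℕ → Set
SamePair A B C D = ((A ↭ C) × (B ↭ D)) ⊎ ((A ↭ D) × (B ↭ C))

module Submission where

-- Let
-- {A,B} be irreducible with every element of A at most P+1 and every element
-- of B at most Q+1, and suppose the first element of A is at most P.  Merge A
-- and B greedily: at each step take the next element of A when the current
-- prefix sum of A does not exceed that of B, else the next element of B.  For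
-- the first ℓ(A,B) states (i,j) of this walk the differences
-- σA(i) − σB(j) of prefix sums lie in the window [−Q, P], and they are
-- pairwise distinct, since two equal differences would exhibit a nonempty
-- proper segment of A and one of B with equal sums.  Counting gives
-- ℓ(A,B) ≤ P + Q + 1.  Moving an element to the front of A preserves
-- irreducibility, so the bound holds as soon as A contains some element ≤ P.
--
-- For k = m + 2 and ℓ(A,B) = 2k − 1 this forces the theorem: A and B cannot
-- both contain k (the singletons {k},{k} would have equal sums), so one side,
-- say B, has all elements ≤ k − 1; the length bound then pins every element
-- of A to k and every element of B to k − 1, and ΣA = ΣB fixes the counts.

open import Defs
open import Data.Nat using (ℕ; zero; suc; _+_; _*_; _∸_; _≤_; _<_; _≤′_; ≤′-reflexive; ≤′-step; z≤n; s≤s; _≤?_; _<?_)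
open import Data.Nat.Properties
open import Data.Nat.ListAction using (sum)
open import Data.Nat.ListAction.Properties using (sum-↭)
open import Data.List using (List; []; _∷_; _++_; take; length; replicate)
open import Data.List.Properties using (take-all; length-replicate)
open import Data.List.Relation.Unary.All as All using (All; []; _∷_; all?)
open import Data.List.Relation.Unary.All.Properties using (¬All⇒Any¬; ++⁻)
open import Data.List.Membership.Propositional using (_∈_; find)
open import Data.List.Membership.Propositional.Properties using (∈-∃++)
open import Data.List.Relation.Binary.Sublist.Propositional using (_⊆_; []; _∷_; _∷ʳ_; from∈)
open import Data.List.Relation.Binary.Sublist.Propositional.Properties using (length-mono-≤; to-≋; ++⁺; take-⊆)
open import Data.List.Relation.Binary.Equality.Propositional using (≋⇒≡)
open import Data.List.Relation.Binary.Permutation.Propositional using (_↭_; ↭-refl; ↭-sym; ↭-reflexive)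
open import Data.List.Relation.Binary.Permutation.Propositional.Properties using (↭-length; shift; All-resp-↭)
open import Data.Fin using (toℕ; fromℕ<)
open import Data.Fin.Properties using (pigeonhole; toℕ<n; toℕ-fromℕ<)
open import Data.Product using (_×_; _,_; proj₁; proj₂; ∃; ∃₂; map; swap)
open import Data.Sum using (inj₁; inj₂)
open import Data.Empty using (⊥; ⊥-elim)
open import Relation.Nullary using (¬_; yes; no; contradiction)
open import Function.Bundles using (_⇔_; mk⇔)
open import Algebra.Properties.CommutativeSemigroup +-commutativeSemigroup
  using () renaming (xy∙z≈xz∙y to +-right-swap)
open import Relation.Binary.PropositionalEquality
  using (_≡_; _≢_; refl; sym; trans; cong; cong₂; subst; subst₂; module ≡-Reasoning)

private
  variable
    c i i' j j' k P Q : ℕ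
    xs S A B : List ℕ

Positive : List ℕ → Set
Positive = All (1 ≤_)

sum-mono-⊆ : S ⊆ xs → sum S ≤ sum xs
sum-mono-⊆ [] = z≤n
sum-mono-⊆ (x ∷ʳ τ) = ≤-trans (sum-mono-⊆ τ) (m≤n+m _ x)
sum-mono-⊆ (_∷_ {x = x} refl τ) = +-monoʳ-≤ x (sum-mono-⊆ τ)

sum-strict-⊆ : Positive xs → S ⊆ xs → length S < length xs → sum S < sum xs
sum-strict-⊆ (p ∷ ps) (x ∷ʳ τ) _ = ≤-trans (s≤s (sum-mono-⊆ τ)) (+-monoˡ-≤ _ p)
sum-strict-⊆ (_ ∷ ps) (_∷_ {x = x} refl τ) (s≤s lt) = +-monoʳ-< x (sum-strict-⊆ ps τ lt)

⊆-full : S ⊆ xs → length xs ≤ length S → S ≡ xs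
⊆-full τ long = ≋⇒≡ (to-≋ (≤-antisym (length-mono-≤ τ) long) τ)

proper-of-sum : S ⊆ xs → sum S < sum xs → length S < length xs
proper-of-sum {S} {xs} τ lt with length S <? length xs
... | yes shorter = shorter
... | no notShorter = contradiction (cong sum (⊆-full τ (≮⇒≥ notShorter))) (<⇒≢ lt)

nonempty-of-sum : 0 < sum S → S ≢ []
nonempty-of-sum () refl

irreducible-sym : Irreducible A B → Irreducible B A
irreducible-sym (pA , pB , balanced , noSub) =
  pB , pA , sym balanced , λ B' A' subB subA e → noSub A' B' subA subB (sym e)

positiveˡ : Irreducible A B → Positive A
positiveˡ (pA , _) = proj₂ pA

positiveʳ : Irreducible A B → Positive B
positiveʳ (_ , pB , _) = proj₂ pB

balanced : Irreducible A B → sum A ≡ sum B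
balanced (_ , _ , e , _) = e

no-common-subsum : ∀ {A' B'} → Irreducible A B → A' ⊆ A → B' ⊆ B →
                   0 < sum A' → sum A' < sum A → sum A' ≢ sum B'
no-common-subsum (_ , _ , bal , noSub) τ υ pos lt e =
  noSub _ _ (τ , nonempty-of-sum pos , proper-of-sum τ lt)
            (υ , nonempty-of-sum (subst (0 <_) e pos) , proper-of-sum υ (subst₂ _<_ e bal lt)) e

irreducible-transport : ∀ {A'} → A' ↭ A → (∀ {S} → S ⊆ A' → ∃ λ T → T ⊆ A × S ↭ T) →
                        Irreducible A B → Irreducible A' B
irreducible-transport {A = A} {B = B} π transport ((neA , pA) , pB , bal , noSub) =
  (nonempty-↭ π neA , All-resp-↭ (↭-sym π) pA) , pB , trans (sum-↭ π) bal , noSub'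
  where
  empty-of-length : ∀ {ys : List ℕ} → length ys ≡ 0 → ys ≡ []
  empty-of-length {[]} _ = refl

  nonempty-↭ : ∀ {ys zs : List ℕ} → ys ↭ zs → zs ≢ [] → ys ≢ []
  nonempty-↭ ρ ne refl = ne (empty-of-length (sym (↭-length ρ)))

  noSub' : ∀ A'' B' → NonemptyProperSub A'' _ → NonemptyProperSub B' B → sum A'' ≢ sum B'
  noSub' A'' B' (τ , ne , proper) subB e with transport τ
  ... | T , υ , ρ = noSub T B' (υ , nonempty-↭ (↭-sym ρ) ne , proper') subB (trans (sym (sum-↭ ρ)) e)
    where
    proper' : length T < length A
    proper' = subst₂ _<_ (↭-length ρ) (↭-length π) proper

⊆-split : ∀ us {vs} → S ⊆ us ++ vs → ∃₂ λ S₁ S₂ → S ≡ S₁ ++ S₂ × S₁ ⊆ us × S₂ ⊆ vs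
⊆-split [] τ = [] , _ , refl , [] , τ
⊆-split (u ∷ us) (.u ∷ʳ τ) with ⊆-split us τ
... | S₁ , S₂ , refl , τ₁ , τ₂ = S₁ , S₂ , refl , u ∷ʳ τ₁ , τ₂
⊆-split (u ∷ us) (refl ∷ τ) with ⊆-split us τ
... | S₁ , S₂ , refl , τ₁ , τ₂ = u ∷ S₁ , S₂ , refl , refl ∷ τ₁ , τ₂

⊆-move-front : ∀ x us {vs} → S ⊆ x ∷ us ++ vs → ∃ λ T → T ⊆ us ++ x ∷ vs × S ↭ T
⊆-move-front x us (.x ∷ʳ τ) with ⊆-split us τ
... | S₁ , S₂ , refl , τ₁ , τ₂ = S₁ ++ S₂ , ++⁺ τ₁ (x ∷ʳ τ₂) , ↭-refl
⊆-move-front x us (refl ∷ τ) with ⊆-split us τ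
... | S₁ , S₂ , refl , τ₁ , τ₂ = S₁ ++ x ∷ S₂ , ++⁺ τ₁ (refl ∷ τ₂) , ↭-sym (shift x S₁ S₂)

move-to-front : ∀ {x} → x ∈ A → Irreducible A B →
                ∃ λ rest → (x ∷ rest) ↭ A × Irreducible (x ∷ rest) B
move-to-front {x = x} x∈A irr with ∈-∃++ x∈A
... | us , vs , refl = us ++ vs , π , irreducible-transport π (⊆-move-front x us) irr
  where
  π : (x ∷ us ++ vs) ↭ (us ++ x ∷ vs)
  π = ↭-sym (shift x us vs)

prefixSum : List ℕ → ℕ → ℕ
prefixSum xs i = sum (take i xs)

prefixSum-mono : ∀ xs → i ≤ i' → prefixSum xs i ≤ prefixSum xs i'
prefixSum-mono xs z≤n = z≤n
prefixSum-mono [] (s≤s _) = z≤n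
prefixSum-mono (x ∷ xs) (s≤s le) = +-monoʳ-≤ x (prefixSum-mono xs le)

prefixSum-strict : Positive xs → i < i' → i' ≤ length xs → prefixSum xs i < prefixSum xs i'
prefixSum-strict {x ∷ xs} {zero} (p ∷ _) (s≤s _) (s≤s _) = ≤-trans p (m≤m+n x _)
prefixSum-strict {x ∷ xs} {suc i} (_ ∷ ps) (s≤s lt) (s≤s le) = +-monoʳ-< x (prefixSum-strict ps lt le)

prefixSum-full : ∀ xs → length xs ≤ i → prefixSum xs i ≡ sum xs
prefixSum-full {i} xs long = cong sum (take-all i xs long)

prefixSum-below-sum : Positive xs → i < length xs → prefixSum xs i < sum xs
prefixSum-below-sum {xs} {i} ps lt =
  subst (prefixSum xs i <_) (prefixSum-full xs ≤-refl) (prefixSum-strict ps lt ≤-refl)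

prefixSum-step : All (_≤ c) xs → prefixSum xs (suc i) ≤ prefixSum xs i + c
prefixSum-step [] = z≤n
prefixSum-step {i = zero} (_∷_ {x = x} b _) = ≤-trans (≤-reflexive (+-identityʳ x)) b
prefixSum-step {c} {i = suc i} (_∷_ {x = x} _ bs) =
  ≤-trans (+-monoʳ-≤ x (prefixSum-step bs)) (≤-reflexive (sym (+-assoc x _ c)))

segment : ∀ xs → i ≤ i' → ∃ λ S → S ⊆ xs × prefixSum xs i + sum S ≡ prefixSum xs i'
segment {i' = i'} xs z≤n = take i' xs , take-⊆ i' xs , refl
segment [] (s≤s _) = [] , [] , refl
segment (x ∷ xs) (s≤s le) with segment xs le
... | S , τ , e = S , x ∷ʳ τ , trans (+-assoc x _ (sum S)) (cong (x +_) e)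

-- Irreducibility seen through prefix sums: if (i,j) ≤ (i',j') componentwise,
-- the pairs differ and (i',j') is not (|A|,|B|), then σA(i') − σA(i) and
-- σB(j') − σB(j) differ, as the two segments would be nonempty proper
-- sublists with equal sums.
prefixes-differ : Irreducible A B →
                  i ≤ i' → i' ≤ length A → j ≤ j' → j' ≤ length B →
                  i + j < i' + j' → i' + j' < length A + length B →
                  prefixSum A i + prefixSum B j' ≢ prefixSum A i' + prefixSum B j
prefixes-differ {A} {B} {i} {i'} {j} {j'} irr ii' i'A jj' j'B progress unfinished e
  with segment A ii' | segment B jj'
... | S , τ , eS | T , υ , eT = no-common-subsum irr τ υ positive below same
  where
  open ≡-Reasoning
  σAi = prefixSum A i
  σBj = prefixSum B j

  same : sum S ≡ sum T
  same = +-cancelˡ-≡ (σAi + σBj) _ _ (begin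
    σAi + σBj + sum S   ≡⟨ +-right-swap σAi σBj (sum S) ⟩
    σAi + sum S + σBj   ≡⟨ cong (_+ σBj) eS ⟩
    prefixSum A i' + σBj ≡⟨ sym e ⟩
    σAi + prefixSum B j' ≡⟨ cong (σAi +_) (sym eT) ⟩
    σAi + (σBj + sum T) ≡⟨ sym (+-assoc σAi σBj (sum T)) ⟩
    σAi + σBj + sum T   ∎)

  gap-positive : ∀ {a b s} → a < b → a + s ≡ b → 0 < s
  gap-positive {a} {s = zero} lt e = contradiction (trans (sym (+-identityʳ a)) e) (<⇒≢ lt)
  gap-positive {s = suc _} _ _ = s≤s z≤n

  positive : 0 < sum S
  positive with m≤n⇒m<n∨m≡n ii'
  ... | inj₁ i<i' = gap-positive (prefixSum-strict (positiveˡ irr) i<i' i'A) eS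
  ... | inj₂ refl = subst (0 <_) (sym same)
                      (gap-positive (prefixSum-strict (positiveʳ irr) (+-cancelˡ-< i _ _ progress) j'B) eT)

  below : sum S < sum A
  below with m≤n⇒m<n∨m≡n i'A
  ... | inj₁ i'<A = ≤-<-trans (subst (sum S ≤_) eS (m≤n+m _ _)) (prefixSum-below-sum (positiveˡ irr) i'<A)
  ... | inj₂ refl = subst (sum S <_) (sym (balanced irr))
                      (≤-<-trans (subst (sum S ≤_) (trans (cong (σBj +_) same) eT) (m≤n+m _ _))
                        (prefixSum-below-sum (positiveʳ irr) (+-cancelˡ-< (length A) _ _ unfinished)))

distinct-values-bound : ∀ {L N} (f : ℕ → ℕ) → (∀ {t} → t < L → f t < N) →
                        (∀ {t t'} → t < t' → t' < L → f t ≢ f t') → L ≤ N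
distinct-values-bound {L} {N} f range distinct with L ≤? N
... | yes L≤N = L≤N
... | no L≰N with pigeonhole (≰⇒> L≰N) (λ t → fromℕ< (range (toℕ<n t)))
...   | t , t' , t<t' , collide =
  ⊥-elim (distinct t<t' (toℕ<n t') (trans (sym (toℕ-fromℕ< _)) (trans (cong toℕ collide) (toℕ-fromℕ< _))))

∸-cross : ∀ {x x' b b'} → b ≤ x → b' ≤ x' → x ∸ b ≡ x' ∸ b' → x + b' ≡ x' + b
∸-cross {x} {x'} {b} {b'} le le' e = begin
  x + b'             ≡⟨ cong (_+ b') (sym (m∸n+n≡m le)) ⟩
  x ∸ b + b + b'     ≡⟨ +-right-swap (x ∸ b) b b' ⟩
  x ∸ b + b' + b     ≡⟨ cong (λ d → d + b' + b) e ⟩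
  x' ∸ b' + b' + b   ≡⟨ cong (_+ b) (m∸n+n≡m le') ⟩
  x' + b             ∎
  where open ≡-Reasoning

module GreedyWalk {A B : List ℕ} (irr : Irreducible A B) where

  σA σB : ℕ → ℕ
  σA = prefixSum A
  σB = prefixSum B

  L : ℕ
  L = ℓ A B

  data Step (i j : ℕ) : ℕ × ℕ → Set where
    stepA : σA i ≤ σB j → Step i j (suc i , j)
    stepB : σB j < σA i → Step i j (i , suc j)

  step : ℕ × ℕ → ℕ × ℕ
  step (i , j) with σA i ≤? σB j
  ... | yes _ = suc i , j
  ... | no _ = i , suc j

  step-spec : ∀ i j → Step i j (step (i , j))
  step-spec i j with σA i ≤? σB j
  ... | yes le = stepA le
  ... | no gt = stepB (≰⇒> gt)

  walk : ℕ → ℕ × ℕ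
  walk zero = 0 , 0
  walk (suc t) = step (walk t)

  I J : ℕ → ℕ
  I t = proj₁ (walk t)
  J t = proj₂ (walk t)

  transition : ∀ t → Step (I t) (J t) (I (suc t) , J (suc t))
  transition t = step-spec (I t) (J t)

  walk-length : ∀ t → I t + J t ≡ t
  walk-length zero = refl
  walk-length (suc t) = trans (consumed (transition t)) (cong suc (walk-length t))
    where
    consumed : Step i j (i' , j') → i' + j' ≡ suc (i + j)
    consumed (stepA _) = refl
    consumed {i} {j} (stepB _) = +-suc i j

  walk-mono : ∀ {t t'} → t ≤ t' → I t ≤ I t' × J t ≤ J t'
  walk-mono le = mono′ (≤⇒≤′ le)
    where
    step-mono : Step i j (i' , j') → i ≤ i' × j ≤ j'
    step-mono (stepA _) = n≤1+n _ , ≤-refl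
    step-mono (stepB _) = ≤-refl , n≤1+n _
    mono′ : ∀ {t t'} → t ≤′ t' → I t ≤ I t' × J t ≤ J t'
    mono′ (≤′-reflexive refl) = ≤-refl , ≤-refl
    mono′ (≤′-step {t'} le) with mono′ le | step-mono (transition t')
    ... | a , b | c , d = ≤-trans a c , ≤-trans b d

  walk-bounds : ∀ t → t ≤ L → I t ≤ length A × J t ≤ length B
  walk-bounds zero _ = z≤n , z≤n
  walk-bounds (suc t) t<L = bounded (transition t) (walk-bounds t (<⇒≤ t<L))
                                      (subst (_< L) (sym (walk-length t)) t<L)
    where
    bounded : Step i j (i' , j') → i ≤ length A × j ≤ length B → i + j < L →
              i' ≤ length A × j' ≤ length B
    bounded {i} {j} (stepA le) (iA , jB) unfinished with m≤n⇒m<n∨m≡n iA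
    ... | inj₁ i<A = i<A , jB
    ... | inj₂ refl = contradiction le (<⇒≱ (begin-strict
          σB j   <⟨ prefixSum-below-sum (positiveʳ irr) (+-cancelˡ-< (length A) _ _ unfinished) ⟩
          sum B  ≡⟨ sym (balanced irr) ⟩
          sum A  ≡⟨ sym (prefixSum-full A ≤-refl) ⟩
          σA i   ∎))
      where open ≤-Reasoning
    bounded {i} {j} (stepB gt) (iA , jB) _ with m≤n⇒m<n∨m≡n jB
    ... | inj₁ j<B = iA , j<B
    ... | inj₂ refl = contradiction gt (≤⇒≯ (begin
          σA i   ≤⟨ sum-mono-⊆ (take-⊆ i A) ⟩
          sum A  ≡⟨ balanced irr ⟩
          sum B  ≡⟨ sym (prefixSum-full B ≤-refl) ⟩
          σB j   ∎))
      where open ≤-Reasoning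

  walk-distinct : ∀ {t t'} → t < t' → t' < L →
                  σA (I t) + σB (J t') ≢ σA (I t') + σB (J t)
  walk-distinct {t} {t'} t<t' t'<L =
    prefixes-differ irr (proj₁ mono) (proj₁ bounds) (proj₂ mono) (proj₂ bounds)
      (subst₂ _<_ (sym (walk-length t)) (sym (walk-length t')) t<t')
      (subst (_< L) (sym (walk-length t')) t'<L)
    where
    mono = walk-mono (<⇒≤ t<t')
    bounds = walk-bounds t' (<⇒≤ t'<L)

  module Window (boundA : All (_≤ suc P) A) (boundB : All (_≤ suc Q) B) (head : σA 1 ≤ P) where

    InWindow : ℕ → ℕ → Set
    InWindow i j = σB j ≤ σA i + Q × σA i ≤ σB j + P

    -- One step preserves the window; an A-step from a tie σA i ≡ σB j is the
    -- one case the bounds alone do not control, so it is a hypothesis.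
    window-step : Step i j (i' , j') → (σA i ≡ σB j → σA (suc i) ≤ σB j + P) →
                  InWindow i j → InWindow i' j'
    window-step {i} {j} (stepA le) tie (lower , _) =
      ≤-trans lower (+-monoˡ-≤ Q (prefixSum-mono A (n≤1+n i))) , upper
      where
      upper : σA (suc i) ≤ σB j + P
      upper with m≤n⇒m<n∨m≡n le
      ... | inj₂ e = tie e
      ... | inj₁ lt = ≤-trans (prefixSum-step boundA)
                        (≤-trans (≤-reflexive (+-suc (σA i) P)) (+-monoˡ-≤ P lt))
    window-step {i} {j} (stepB gt) _ (_ , upper) =
      ≤-trans (prefixSum-step boundB) (≤-trans (≤-reflexive (+-suc (σB j) Q)) (+-monoˡ-≤ Q gt)) ,
      ≤-trans upper (+-monoˡ-≤ P (prefixSum-mono B (n≤1+n j)))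

    -- Ties occur only at time 0 (by walk-distinct), where the head bound applies.
    tie-only-at-start : ∀ t → t < L → σA (I t) ≡ σB (J t) → σA (suc (I t)) ≤ σB (J t) + P
    tie-only-at-start zero _ _ = head
    tie-only-at-start (suc t) t<L e =
      ⊥-elim (walk-distinct (s≤s z≤n) t<L (trans (sym e) (sym (+-identityʳ _))))

    walk-window : ∀ t → t < L → InWindow (I t) (J t)
    walk-window zero _ = z≤n , z≤n
    walk-window (suc t) t<L =
      window-step (transition t) (tie-only-at-start t t≤L) (walk-window t t≤L)
      where t≤L = <-trans (n<1+n t) t<L

    -- the difference σA − σB at time t, shifted by Q into ℕ
    gap : ℕ → ℕ
    gap t = σA (I t) + Q ∸ σB (J t)

    gap-range : ∀ {t} → t < L → gap t < suc (P + Q)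
    gap-range {t} t<L with walk-window t t<L
    ... | _ , upper = s≤s (begin
      σA (I t) + Q ∸ σB (J t)       ≤⟨ ∸-monoˡ-≤ (σB (J t)) (+-monoˡ-≤ Q upper) ⟩
      σB (J t) + P + Q ∸ σB (J t)   ≡⟨ cong (_∸ σB (J t)) (+-assoc (σB (J t)) P Q) ⟩
      σB (J t) + (P + Q) ∸ σB (J t) ≡⟨ m+n∸m≡n (σB (J t)) (P + Q) ⟩
      P + Q                         ∎)
      where open ≤-Reasoning

    gap-distinct : ∀ {t t'} → t < t' → t' < L → gap t ≢ gap t'
    gap-distinct {t} {t'} t<t' t'<L e = walk-distinct t<t' t'<L (+-cancelʳ-≡ Q _ _ (begin
      σA (I t) + σB (J t') + Q   ≡⟨ +-right-swap (σA (I t)) (σB (J t')) Q ⟩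
      σA (I t) + Q + σB (J t')   ≡⟨ ∸-cross (proj₁ (walk-window t (<-trans t<t' t'<L)))
                                            (proj₁ (walk-window t' t'<L)) e ⟩
      σA (I t') + Q + σB (J t)   ≡⟨ +-right-swap (σA (I t')) Q (σB (J t)) ⟩
      σA (I t') + σB (J t) + Q   ∎))
      where open ≡-Reasoning

    counting-bound : L ≤ suc (P + Q)
    counting-bound = distinct-values-bound gap gap-range gap-distinct

length-bound : ∀ {x} → Irreducible A B → All (_≤ suc P) A → All (_≤ suc Q) B →
               x ∈ A → x ≤ P → ℓ A B ≤ suc (P + Q)
length-bound {A} {B} {P} {Q} {x} irr boundA boundB x∈A x≤P with move-to-front x∈A irr
... | rest , π , irr' = subst (_≤ suc (P + Q)) (cong (_+ length B) (↭-length π))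
  (GreedyWalk.Window.counting-bound irr' (All-resp-↭ (↭-sym π) boundA) boundB
    (≤-trans (≤-reflexive (+-identityʳ x)) x≤P))

pinned : All (_≤ suc c) xs → (∀ {x} → x ∈ xs → x ≤ c → ⊥) → All (_≡ suc c) xs
pinned {c} {xs} bound notSmall = All.tabulate λ {x} x∈ → ≤-antisym (All.lookup bound x∈) (big x x∈)
  where
  big : ∀ x → x ∈ xs → suc c ≤ x
  big x x∈ with x ≤? c
  ... | yes small = ⊥-elim (notSmall x∈ small)
  ... | no notSmall' = ≰⇒> notSmall'

max-attained : All (_≤ suc c) xs → ¬ All (_≤ c) xs → suc c ∈ xs
max-attained {c} {xs} bound notAll with find (¬All⇒Any¬ (_≤? c) xs notAll)
... | y , y∈ , big = subst (_∈ xs) (≤-antisym (All.lookup bound y∈) (≰⇒> big)) y∈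

constant-list : All (_≡ c) xs → xs ≡ replicate (length xs) c
constant-list [] = refl
constant-list (refl ∷ es) = cong (_ ∷_) (constant-list es)

sum-replicate : ∀ n c → sum (replicate n c) ≡ n * c
sum-replicate zero c = refl
sum-replicate (suc n) c = cong (c +_) (sum-replicate n c)

count-solution : ∀ m x y → x + y ≡ suc m + suc (suc m) →
                 x * suc (suc m) ≡ y * suc m → x ≡ suc m
count-solution m x y total e = *-cancelʳ-≡ x (suc m) (suc m + suc (suc m)) (begin
  x * (suc m + suc (suc m))     ≡⟨ *-distribˡ-+ x (suc m) (suc (suc m)) ⟩
  x * suc m + x * suc (suc m)   ≡⟨ cong (x * suc m +_) e ⟩
  x * suc m + y * suc m         ≡⟨ sym (*-distribʳ-+ (suc m) x y) ⟩
  (x + y) * suc m               ≡⟨ cong (_* suc m) total ⟩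
  (suc m + suc (suc m)) * suc m ≡⟨ *-comm (suc m + suc (suc m)) (suc m) ⟩
  suc m * (suc m + suc (suc m)) ∎)
  where open ≡-Reasoning

common-element : Irreducible A B → k ∈ A → k ∈ B → 3 ≤ ℓ A B → ⊥
common-element {A} {B} {k} irr k∈A k∈B long =
  no-common-subsum irr (from∈ k∈A) (from∈ k∈B) positive below refl
  where
  positive : 0 < k + 0
  positive = subst (0 <_) (sym (+-identityʳ k)) (All.lookup (positiveˡ irr) k∈A)

  below : k + 0 < sum A
  below with 2 ≤? length A
  ... | yes twoA = sum-strict-⊆ (positiveˡ irr) (from∈ k∈A) twoA
  ... | no shortA = subst (k + 0 <_) (sym (balanced irr))
                      (sum-strict-⊆ (positiveʳ irr) (from∈ k∈B) twoB)
    where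
    twoB : 2 ≤ length B
    twoB = +-cancelˡ-≤ 1 2 (length B)
             (≤-trans long (+-monoˡ-≤ (length B) (≤-pred (≰⇒> shortA))))

extremal : ∀ m → Irreducible A B → All (_≤ suc (suc m)) A → All (_≤ suc m) B →
           ℓ A B ≡ suc m + suc (suc m) →
           A ≡ replicate (suc m) (suc (suc m)) × B ≡ replicate (suc (suc m)) (suc m)
extremal {A} {B} m irr boundA boundB total =
  trans (constant-list allA) (cong (λ n → replicate n _) countA) ,
  trans (constant-list allB) (cong (λ n → replicate n _) countB)
  where
  target : suc m + suc (suc m) ≡ suc (suc (suc (m + m)))
  target = cong suc (trans (+-suc m (suc m)) (cong suc (+-suc m m)))

  allA : All (_≡ suc (suc m)) A
  allA = pinned boundA λ x∈ small →
    <-irrefl (trans total target) (s≤s (length-bound irr boundA boundB x∈ small))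

  allB : All (_≡ suc m) B
  allB = pinned boundB λ y∈ small →
    <-irrefl (trans total target)
      (s≤s (subst₂ _≤_ (+-comm (length B) (length A)) (cong suc (+-suc m m))
        (length-bound (irreducible-sym irr) boundB boundA y∈ small)))

  sums : length A * suc (suc m) ≡ length B * suc m
  sums = begin
    length A * suc (suc m)              ≡⟨ sym (sum-replicate (length A) _) ⟩
    sum (replicate (length A) _)        ≡⟨ cong sum (sym (constant-list allA)) ⟩
    sum A                               ≡⟨ balanced irr ⟩
    sum B                               ≡⟨ cong sum (constant-list allB) ⟩
    sum (replicate (length B) (suc m))  ≡⟨ sum-replicate (length B) _ ⟩
    length B * suc m                    ∎
    where open ≡-Reasoning

  countA : length A ≡ suc m
  countA = count-solution m (length A) (length B) total sums

  countB : length B ≡ suc (suc m)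
  countB = +-cancelˡ-≡ (length A) _ _ (trans total (cong (_+ suc (suc m)) (sym countA)))

length-↭-replicate : ∀ {n} → xs ↭ replicate n c → length xs ≡ n
length-↭-replicate {n = n} π = trans (↭-length π) (length-replicate n)

corollary1 : (k : ℕ) → 1 < k → (A B : List ℕ) → KIrreducible k A B →
    (ℓ A B ≡ 2 * k ∸ 1) ⇔ SamePair A B (replicate (k ∸ 1) k) (replicate k (k ∸ 1))
corollary1 (suc (suc m)) (s≤s (s≤s z≤n)) A B (irr , bounded) = mk⇔ forward backward
  where
  boundA : All (_≤ suc (suc m)) A
  boundA = proj₁ (++⁻ A bounded)

  boundB : All (_≤ suc (suc m)) B
  boundB = proj₂ (++⁻ A bounded)

  target : 2 * suc (suc m) ∸ 1 ≡ suc m + suc (suc m)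
  target = cong (λ n → suc (m + suc (suc n))) (+-identityʳ m)

  forward : ℓ A B ≡ 2 * suc (suc m) ∸ 1 →
            SamePair A B (replicate (suc m) (suc (suc m))) (replicate (suc (suc m)) (suc m))
  forward hl with all? (_≤? suc m) B | all? (_≤? suc m) A
  ... | yes smallB | _ =
    inj₁ (map ↭-reflexive ↭-reflexive (extremal m irr boundA smallB (trans hl target)))
  ... | no _ | yes smallA =
    inj₂ (swap (map ↭-reflexive ↭-reflexive (extremal m (irreducible-sym irr) boundB smallA
      (trans (+-comm (length B) (length A)) (trans hl target)))))
  ... | no bigB | no bigA =
    ⊥-elim (common-element irr (max-attained boundA bigA) (max-attained boundB bigB)
      (subst (3 ≤_) (sym (trans hl target)) (+-mono-≤ (s≤s z≤n) (s≤s (s≤s z≤n)))))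

  backward : SamePair A B (replicate (suc m) (suc (suc m))) (replicate (suc (suc m)) (suc m)) →
             ℓ A B ≡ 2 * suc (suc m) ∸ 1
  backward (inj₁ (πA , πB)) =
    trans (cong₂ _+_ (length-↭-replicate πA) (length-↭-replicate πB)) (sym target)
  backward (inj₂ (πA , πB)) =
    trans (cong₂ _+_ (length-↭-replicate πA) (length-↭-replicate πB))
      (trans (+-comm (suc (suc m)) (suc m)) (sym target))
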